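{- Let $3 \le p \le q$ and let $D$ be a strong orientation of $K(3,p,q)$ with diameter two, with parts $V_1=\{x_1,x_2,x_3\}$, $V_2$ ($|V_2|=p$), $V_3$ ($|V_3|=q$). If $V_2 = V_2^{[3]} \cup V_2^A$ for some nonempty proper subset $A$ of $[3]=\{1,2,3\}$, then $q \le 1 + 3\binom{p-1}{\lfloor \frac{p-1}{2} \rfloor}$.
   Context: $K(3,p,q)$ is the complete tripartite graph with parts $V_1=\{x_1,x_2,x_3\}$, $V_2$ of size $p$, $V_3$ of size $q$. A strong orientation is an orientation of all edges making the digraph strongly connected; its diameter is the maximum directed distance between ordered pairs of vertices. Write $u\to v$ if the edge $uv$ is oriented from $u$ to $v$. For $A \subseteq [3]$, let $N_D^A$ be the set of vertices $w$ such that $x_i \to w$ for all $i \in A$ and $w \to x_j$ for all $j \in [3]\setminus A$, and $V_2^A = V_2 \cap N_D^A$ (so $V_2^{[3]}$ consists of the vertices of $V_2$ that are out-neighbours of all of $x_1,x_2,x_3$). -}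

module Defs where

open import Data.Nat using (ℕ)
open import Data.Fin using (Fin; zero; suc)
open import Data.Fin.Subset using (Subset; _∈_; _∉_)
open import Data.Product using (_×_; ∃; ∃-syntax; Σ)
open import Data.Sum using (_⊎_)
open import Relation.Nullary using (¬_)
open import Relation.Binary.PropositionalEquality using (_≡_)

data Vertex (p q : ℕ) : Set where
  v1 : Fin 3 → Vertex p q
  v2 : Fin p → Vertex p q
  v3 : Fin q → Vertex p q

part : ∀ {p q} → Vertex p q → Fin 3
part (v1 _) = zero
part (v2 _) = suc zero
part (v3 _) = suc (suc zero)

record Orientation (p q : ℕ) : Set₁ where
  field
    _⇒_       : Vertex p q → Vertex p q → Set
    samePart  : ∀ u v → part u ≡ part v → ¬ (u ⇒ v)
    total     : ∀ u v → ¬ (part u ≡ part v) → (u ⇒ v) ⊎ (v ⇒ u)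
    antisym   : ∀ u v → (u ⇒ v) → ¬ (v ⇒ u)

open Orientation public

Dist≤1 : ∀ {p q} → Orientation p q → Vertex p q → Vertex p q → Set
Dist≤1 D u v = (u ≡ v) ⊎ _⇒_ D u v

Dist≤2 : ∀ {p q} → Orientation p q → Vertex p q → Vertex p q → Set
Dist≤2 D u v = Dist≤1 D u v ⊎ (∃[ w ] (_⇒_ D u w × _⇒_ D w v))

-- Strongly connected with diameter exactly two: every ordered pair is at
-- directed distance ≤ 2 (in particular D is strong), and some ordered pair is
-- at distance exactly 2 (not ≤ 1).
DiameterTwo : ∀ {p q} → Orientation p q → Set
DiameterTwo D = (∀ u v → Dist≤2 D u v) × (∃[ u ] ∃[ v ] ¬ Dist≤1 D u v)

InN : ∀ {p q} → Orientation p q → Subset 3 → Vertex p q → Set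
InN D A w = ∀ i → (i ∈ A → _⇒_ D (v1 i) w) × (i ∉ A → _⇒_ D w (v1 i))

-- Pick a ∈ A. Then x_a dominates V2, so every z ∈ V3 has z → x_a. Fix t ∈ V2 and call
-- the arcs of z to x_1, x_2, x_3 and to t its profile. Distinct z, z′ with the same profile
-- are joined by a path z → w → z′, and w can only lie in V2 ∖ {t}; so the out-neighbourhoods
-- in V2 ∖ {t} of one profile class form an antichain, and by Sperner's theorem the class has
-- at most C(p−1, ⌊(p−1)/2⌋) members. If some t ∈ V2^[3] exists, then t → V3, and only four
-- profiles occur: one in which z → V1, which has at most one member (such a z is dominated
-- by all of V2), and three others. Otherwise V2 = V2^A fixes every arc between V1 and V3,
-- and only the two profiles differing at t occur.
--
-- Sperner's theorem comes from the LYM inequality Σ_F |F|! (n − |F|)! ≤ n!, proved by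
-- induction on n: a non-full F has weight Σ_{i ∉ F} |F|! (n − 1 − |F|)!, and the sets of
-- the antichain avoiding i, with i deleted, form an antichain in dimension n − 1.

module Submission where

open import Defs hiding (_⇒_; samePart; total; antisym)
open import Data.Bool using (Bool; true; false; T; if_then_else_)
open import Data.Bool.Properties using (T-≡; T-not-≡) renaming (_≟_ to _≟ᵇ_)
open import Data.Empty using (⊥-elim)
open import Data.Fin using (Fin; zero; suc; punchIn; punchOut) renaming (_≟_ to _≟ᶠ_)
open import Data.Fin.Properties using (punchIn-punchOut; any?; all?)
open import Data.Fin.Subset using (Subset; ⊤; Nonempty)
open import Data.Fin.Subset.Properties using (∈⊤)
open import Data.List using (List; []; _∷_; map; length; filter; _++_; allFin)
open import Data.List.Membership.Propositional using (_∈_; find)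
open import Data.List.Membership.Propositional.Properties using (∈-++⁺ˡ; ∈-++⁺ʳ; ∈-map⁺)
open import Data.List.Properties using (map-cong-local; length-map; length-tabulate; filter-none)
open import Data.List.Relation.Unary.All as All using (All; []; _∷_)
open import Data.List.Relation.Unary.All.Properties using (all-filter; ¬Any⇒All¬)
open import Data.List.Relation.Unary.AllPairs using (AllPairs; []; _∷_)
open import Data.List.Relation.Unary.AllPairs.Properties using (map⁺; filter⁺)
open import Data.List.Relation.Unary.Any as Any using (Any; here; there)
open import Data.List.Relation.Unary.Unique.Propositional using (Unique)
open import Data.List.Relation.Unary.Unique.Propositional.Properties using (allFin⁺)
open import Data.Nat using (ℕ; zero; suc; _+_; _*_; _∸_; _/_; _%_; _≤_; _<_; _!; z≤n; s≤s; _≟_)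
open import Data.Nat.Combinatorics using (_C_; nCk≡n!/k![n-k]!)
open import Data.Nat.DivMod using (m*n/n≡m; /-monoˡ-≤; m/n≤m; m≡m%n+[m/n]*n; m%n<n)
open import Data.Nat.ListAction using (sum)
open import Data.Nat.Properties
open import Algebra.Properties.Semiring.Sum +-*-semiring
  using (sum-remove; ∑-distrib-+; *-distribʳ-sum; sum-replicate-zero; sum-cong-≗)
  renaming (sum to ∑)
open import Algebra.Properties.CommutativeSemigroup *-commutativeSemigroup using (x∙yz≈y∙xz)
open import Data.Product using (_×_; _,_; proj₁; proj₂; ∃-syntax)
open import Data.Sum using (_⊎_; inj₁; inj₂; [_,_]′)
open import Data.Vec using ([]; _∷_; lookup; tabulate; _[_]=_)
open import Data.Vec.Properties
  using (lookup∘tabulate; lookup-replicate; tabulate-cong; tabulate∘lookup; lookup⇒[]=; []=⇒lookup)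
  renaming (≡-dec to ≡-decᵛ)
open import Data.Vec.Functional using (Vector; removeAt; tail)
open import Function using (_∘_; id; Equivalence)
open import Relation.Binary.Definitions using (DecidableEquality)
open import Relation.Binary.PropositionalEquality
open import Relation.Nullary using (¬_; Dec; yes; no; contradiction)
open import Relation.Nullary.Decidable using (isYes; toWitness; fromWitness; fromWitnessFalse)

private variable
  X K : Set
  n : ℕ

allPairs-under : {P : X → Set} {R S : X → X → Set} →
  (∀ {x y} → P x → P y → R x y → S x y) →
  ∀ {xs} → All P xs → AllPairs R xs → AllPairs S xs
allPairs-under h [] [] = []
allPairs-under h (px ∷ pxs) (rx ∷ rxs) =
  All.zipWith (λ (py , r) → h px py r) (pxs , rx) ∷ allPairs-under h pxs rxs

length*≤sum : ∀ {c} (f : X → ℕ) → (∀ x → c ≤ f x) → ∀ xs → length xs * c ≤ sum (map f xs)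
length*≤sum f c≤f []       = z≤n
length*≤sum f c≤f (x ∷ xs) = +-mono-≤ (c≤f x) (length*≤sum f c≤f xs)

sum-map-mono : {f g : X → ℕ} → (∀ x → f x ≤ g x) → ∀ xs → sum (map f xs) ≤ sum (map g xs)
sum-map-mono f≤g []       = z≤n
sum-map-mono f≤g (x ∷ xs) = +-mono-≤ (f≤g x) (sum-map-mono f≤g xs)

sum-map-mono-< : {f g : X → ℕ} → (∀ x → f x ≤ g x) → ∀ {xs} → Any (λ x → f x < g x) xs →
  sum (map f xs) < sum (map g xs)
sum-map-mono-< f≤g {x ∷ xs} (here fx<gx) = +-mono-<-≤ fx<gx (sum-map-mono f≤g xs)
sum-map-mono-< f≤g {x ∷ xs} (there lt)   = +-mono-≤-< (f≤g x) (sum-map-mono-< f≤g lt)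

module _ (_≟ᵏ_ : DecidableEquality K) (key : X → K) where

  class : K → List X → List X
  class k = filter (λ x → key x ≟ᵏ k)

  length-class-∷ : ∀ k x xs → length (class k xs) ≤ length (class k (x ∷ xs))
  length-class-∷ k x xs with key x ≟ᵏ k
  ... | yes _ = n≤1+n _
  ... | no  _ = ≤-refl

  length-class-∷-key : ∀ x xs → length (class (key x) xs) < length (class (key x) (x ∷ xs))
  length-class-∷-key x xs with key x ≟ᵏ key x
  ... | yes _   = ≤-refl
  ... | no  k≢k = contradiction refl k≢k

  length≤∑-class : (ks : List K) → (∀ x → key x ∈ ks) → ∀ xs →
    length xs ≤ sum (map (λ k → length (class k xs)) ks)
  length≤∑-class ks complete []       = z≤n
  length≤∑-class ks complete (x ∷ xs) = ≤-trans (s≤s (length≤∑-class ks complete xs))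
    (sum-map-mono-< (λ k → length-class-∷ k x xs)
      (Any.map (λ { refl → length-class-∷-key x xs }) (complete x)))

length≤1-if-subsingleton : ∀ {P : X → Set} {xs} → Unique xs → All P xs →
  (∀ {x y} → P x → P y → x ≡ y) → length xs ≤ 1
length≤1-if-subsingleton {xs = []}        _               _              _       = z≤n
length≤1-if-subsingleton {xs = _ ∷ []}    _               _              _       = ≤-refl
length≤1-if-subsingleton {xs = _ ∷ _ ∷ _} ((x≢y ∷ _) ∷ _) (px ∷ py ∷ _) P-unique =
  contradiction (P-unique px py) x≢y

∑-≤-const : ∀ {c} (f : Fin n → ℕ) → (∀ i → f i ≤ c) → ∑ f ≤ n * c
∑-≤-const {zero}  f f≤c = z≤n
∑-≤-const {suc n} f f≤c = +-mono-≤ (f≤c zero) (∑-≤-const (λ i → f (suc i)) (λ i → f≤c (suc i)))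

sum-map-∑ : (f : X → Fin n → ℕ) (xs : List X) →
  sum (map (λ x → ∑ (f x)) xs) ≡ ∑ (λ i → sum (map (λ x → f x i) xs))
sum-map-∑ {n = n} f []       = sym (sum-replicate-zero n)
sum-map-∑ f (x ∷ xs) = trans (cong (∑ (f x) +_) (sum-map-∑ f xs)) (sym (∑-distrib-+ (f x) _))

-- Sperner's theorem via the LYM inequality

_⊆_ : Vector Bool n → Vector Bool n → Set
F ⊆ G = ∀ i → T (F i) → T (G i)

Incomparable : Vector Bool n → Vector Bool n → Set
Incomparable F G = ¬ F ⊆ G × ¬ G ⊆ F

Antichain : List (Vector Bool n) → Set
Antichain = AllPairs Incomparable

antichain-with-maximum : ∀ {F} {L : List (Vector Bool n)} → Antichain L → F ∈ L →
  (∀ G → G ⊆ F) → L ≡ F ∷ []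
antichain-with-maximum {L = F ∷ []}    _               (here refl) _  = refl
antichain-with-maximum {L = F ∷ G ∷ _} ((F∥G ∷ _) ∷ _) (here refl) ⊆F = contradiction (⊆F G) (proj₂ F∥G)
antichain-with-maximum {L = G ∷ _}     (G∥L ∷ _)       (there F∈L) ⊆F =
  contradiction (⊆F G) (proj₁ (All.lookup G∥L F∈L))

ones zeros : Vector Bool n → ℕ
ones  F = ∑ (λ i → if F i then 1 else 0)
zeros F = ∑ (λ i → if F i then 0 else 1)

ones+zeros≡n : (F : Vector Bool n) → ones F + zeros F ≡ n
ones+zeros≡n {zero}  F = refl
ones+zeros≡n {suc n} F with F zero
... | true  = cong suc (ones+zeros≡n (tail F))
... | false = trans (+-suc _ _) (cong suc (ones+zeros≡n (tail F)))

ones-removeAt : (F : Vector Bool (suc n)) (i : Fin (suc n)) →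
  ones F ≡ (if F i then 1 else 0) + ones (removeAt F i)
ones-removeAt F i = sum-remove {i = i} (λ j → if F j then 1 else 0)

zeros-removeAt : (F : Vector Bool (suc n)) (i : Fin (suc n)) →
  zeros F ≡ (if F i then 0 else 1) + zeros (removeAt F i)
zeros-removeAt F i = sum-remove {i = i} (λ j → if F j then 0 else 1)

zeros≡0⇒maximum : (F : Vector Bool n) → zeros F ≡ 0 → ∀ G → G ⊆ F
zeros≡0⇒maximum {suc n} F z≡0 G i _ with F i | zeros-removeAt F i
... | true  | _   = _
... | false | z≡1+ = contradiction (trans (sym z≡0) z≡1+) λ ()

weight : Vector Bool n → ℕ
weight F = ones F ! * zeros F !

weight≡∑weight-removeAt : (F : Vector Bool (suc n)) → zeros F ≢ 0 →
  weight F ≡ ∑ (λ i → if F i then 0 else weight (removeAt F i))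
weight≡∑weight-removeAt F z≢0 with zeros F in z≡
... | zero  = contradiction refl z≢0
... | suc m = begin
  ones F ! * (suc m * m !)                              ≡⟨ x∙yz≈y∙xz (ones F !) (suc m) (m !) ⟩
  suc m * c                                             ≡⟨ cong (_* c) z≡ ⟨
  zeros F * c                                           ≡⟨ *-distribʳ-sum c (λ i → if F i then 0 else 1) ⟩
  ∑ (λ i → (if F i then 0 else 1) * c)                  ≡⟨ sum-cong-≗ share ⟩
  ∑ (λ i → if F i then 0 else weight (removeAt F i))    ∎
  where
  open ≡-Reasoning
  c = ones F ! * m !
  share : ∀ i → (if F i then 0 else 1) * c ≡ (if F i then 0 else weight (removeAt F i))
  share i with F i | ones-removeAt F i | zeros-removeAt F i
  ... | true  | _    | _    = refl
  ... | false | o≡   | z≡1+ = trans (+-identityʳ c)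
        (cong₂ (λ a b → a ! * b !) o≡ (suc-injective (trans (sym z≡) z≡1+)))

removeAt-⊆⇒⊆ : {F G : Vector Bool (suc n)} (i : Fin (suc n)) → F i ≡ false →
  removeAt F i ⊆ removeAt G i → F ⊆ G
removeAt-⊆⇒⊆ {F = F} {G} i Fi≡false F∖i⊆G∖i j Fj with i ≟ᶠ j
... | yes refl = ⊥-elim (subst T Fi≡false Fj)
... | no i≢j   = subst (T ∘ G) (punchIn-punchOut i≢j)
                   (F∖i⊆G∖i (punchOut i≢j) (subst (T ∘ F) (sym (punchIn-punchOut i≢j)) Fj))

shrink : Fin (suc n) → List (Vector Bool (suc n)) → List (Vector Bool n)
shrink i L = map (λ F → removeAt F i) (filter (λ F → F i ≟ᵇ false) L)

shrink-antichain : ∀ {L : List (Vector Bool (suc n))} i → Antichain L → Antichain (shrink i L)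
shrink-antichain {L = L} i ac = map⁺ (allPairs-under incomparable (all-filter _ L) (filter⁺ _ ac))
  where
  incomparable : ∀ {F G} → F i ≡ false → G i ≡ false → Incomparable F G →
                 Incomparable (removeAt F i) (removeAt G i)
  incomparable Fi Gi (F⊈G , G⊈F) = F⊈G ∘ removeAt-⊆⇒⊆ i Fi , G⊈F ∘ removeAt-⊆⇒⊆ i Gi

sum-weight-shrink : ∀ i (L : List (Vector Bool (suc n))) →
  sum (map weight (shrink i L)) ≡ sum (map (λ F → if F i then 0 else weight (removeAt F i)) L)
sum-weight-shrink i [] = refl
sum-weight-shrink i (F ∷ L) with F i
... | true  = sum-weight-shrink i L
... | false = cong (weight (removeAt F i) +_) (sum-weight-shrink i L)

sum-weight-with-full : ∀ {F} {L : List (Vector Bool n)} → Antichain L → F ∈ L → zeros F ≡ 0 →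
  sum (map weight L) ≡ n !
sum-weight-with-full {n} {F} {L} ac F∈L zF≡0 = begin
  sum (map weight L)
    ≡⟨ cong (sum ∘ map weight) (antichain-with-maximum ac F∈L (zeros≡0⇒maximum F zF≡0)) ⟩
  ones F ! * zeros F ! + 0
    ≡⟨ cong₂ (λ a b → a ! * b ! + 0) ones≡n zF≡0 ⟩
  n ! * 1 + 0
    ≡⟨ trans (+-identityʳ _) (*-identityʳ _) ⟩
  n !
    ∎
  where
  open ≡-Reasoning
  ones≡n : ones F ≡ n
  ones≡n = trans (sym (+-identityʳ (ones F))) (trans (cong (ones F +_) (sym zF≡0)) (ones+zeros≡n F))

lym : (L : List (Vector Bool n)) → Antichain L → sum (map weight L) ≤ n !
lym L ac with Any.any? (λ F → zeros F ≟ 0) L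
... | yes ∃full with find ∃full
...   | _ , F∈L , zF≡0 = ≤-reflexive (sum-weight-with-full ac F∈L zF≡0)
lym {zero}  []      _  | no _    = z≤n
lym {zero}  (F ∷ _) _  | no none = contradiction (here refl) none
lym {suc n} L       ac | no none = begin
  sum (map weight L)
    ≡⟨ cong sum (map-cong-local (All.map (λ {F} → weight≡∑weight-removeAt F) (¬Any⇒All¬ L none))) ⟩
  sum (map (λ F → ∑ (λ i → if F i then 0 else weight (removeAt F i))) L)
    ≡⟨ sum-map-∑ (λ F i → if F i then 0 else weight (removeAt F i)) L ⟩
  ∑ (λ i → sum (map (λ F → if F i then 0 else weight (removeAt F i)) L))
    ≡⟨ sum-cong-≗ (λ i → sum-weight-shrink i L) ⟨
  ∑ (λ i → sum (map weight (shrink i L)))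
    ≤⟨ ∑-≤-const _ (λ i → lym (shrink i L) (shrink-antichain i ac)) ⟩
  suc n * n !
    ∎
  where open ≤-Reasoning

!*!-step : ∀ {a m} → a ≤ m → suc a ! * m ! ≤ a ! * suc m !
!*!-step {a} {m} a≤m = begin
  (suc a * a !) * m !   ≡⟨ *-assoc (suc a) (a !) (m !) ⟩
  suc a * (a ! * m !)   ≤⟨ *-monoˡ-≤ (a ! * m !) (s≤s a≤m) ⟩
  suc m * (a ! * m !)   ≡⟨ x∙yz≈y∙xz (suc m) (a !) (m !) ⟩
  a ! * (suc m * m !)   ∎
  where open ≤-Reasoning

!*!-shift : ∀ k a d → a + k ≤ suc d → (a + k) ! * d ! ≤ a ! * (k + d) !
!*!-shift zero    a d _   = ≤-reflexive (cong (λ x → x ! * d !) (+-identityʳ a))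
!*!-shift (suc k) a d a+1+k≤1+d = begin
  (a + suc k) ! * d !   ≡⟨ cong (λ x → x ! * d !) (+-suc a k) ⟩
  (suc a + k) ! * d !   ≤⟨ !*!-shift k (suc a) d 1+a+k≤1+d ⟩
  suc a ! * (k + d) !   ≤⟨ !*!-step (≤-trans (m≤m+n a k) (≤-trans (≤-pred 1+a+k≤1+d) (m≤n+m d k))) ⟩
  a ! * suc (k + d) !   ∎
  where
  open ≤-Reasoning
  1+a+k≤1+d : suc a + k ≤ suc d
  1+a+k≤1+d = subst (_≤ suc d) (+-suc a k) a+1+k≤1+d

!*!-decreases-toward-balance : ∀ {a b c d} → a ≤ c → c ≤ suc d → a + b ≡ c + d →
  c ! * d ! ≤ a ! * b !
!*!-decreases-toward-balance {a} {b} {c} {d} a≤c c≤1+d a+b≡c+d =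
  subst₂ (λ x y → x ! * d ! ≤ a ! * y !) a+[c∸a]≡c c∸a+d≡b
    (!*!-shift (c ∸ a) a d (subst (_≤ suc d) (sym a+[c∸a]≡c) c≤1+d))
  where
  a+[c∸a]≡c : a + (c ∸ a) ≡ c
  a+[c∸a]≡c = m+[n∸m]≡n a≤c
  c∸a+d≡b : c ∸ a + d ≡ b
  c∸a+d≡b = +-cancelˡ-≡ a _ _ (trans (sym (+-assoc a (c ∸ a) d))
              (trans (cong (_+ d) a+[c∸a]≡c) (sym a+b≡c+d)))

!*!-minimal-at-balance : ∀ {a b c d} → c ≤ suc d → d ≤ suc c → a + b ≡ c + d →
  c ! * d ! ≤ a ! * b !
!*!-minimal-at-balance {a} {b} {c} {d} c≤1+d d≤1+c a+b≡c+d with ≤-total a c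
... | inj₁ a≤c = !*!-decreases-toward-balance a≤c c≤1+d a+b≡c+d
... | inj₂ c≤a = subst₂ _≤_ (*-comm (d !) (c !)) (*-comm (b !) (a !))
                   (!*!-decreases-toward-balance b≤d d≤1+c b+a≡d+c)
  where
  b≤d : b ≤ d
  b≤d = +-cancelˡ-≤ c b d (≤-trans (+-monoˡ-≤ b c≤a) (≤-reflexive a+b≡c+d))
  b+a≡d+c : b + a ≡ d + c
  b+a≡d+c = trans (+-comm b a) (trans a+b≡c+d (+-comm c d))

n∸n/2≡n%2+n/2 : ∀ n → n ∸ n / 2 ≡ n % 2 + n / 2
n∸n/2≡n%2+n/2 n = begin
  n ∸ h                         ≡⟨ cong (_∸ h) (m≡m%n+[m/n]*n n 2) ⟩
  n % 2 + h * 2 ∸ h             ≡⟨ cong (λ x → n % 2 + x ∸ h) (*-comm h 2) ⟩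
  n % 2 + (h + (h + 0)) ∸ h     ≡⟨ cong (λ x → n % 2 + (h + x) ∸ h) (+-identityʳ h) ⟩
  n % 2 + (h + h) ∸ h           ≡⟨ cong (_∸ h) (+-assoc (n % 2) h h) ⟨
  n % 2 + h + h ∸ h             ≡⟨ m+n∸n≡m (n % 2 + h) h ⟩
  n % 2 + h                     ∎
  where
  open ≡-Reasoning
  h : ℕ
  h = n / 2

n/2-balanced : ∀ n → n / 2 ≤ suc (n ∸ n / 2) × n ∸ n / 2 ≤ suc (n / 2)
n/2-balanced n rewrite n∸n/2≡n%2+n/2 n =
  m≤n⇒m≤1+n (m≤n+m (n / 2) (n % 2)) , +-monoˡ-≤ (n / 2) (≤-pred (m%n<n n 2))

weight-minimum : (F : Vector Bool n) → (n / 2) ! * (n ∸ n / 2) ! ≤ weight F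
weight-minimum {n} F = !*!-minimal-at-balance {ones F} {zeros F}
  (proj₁ (n/2-balanced n)) (proj₂ (n/2-balanced n)) (trans (ones+zeros≡n F) (sym (m+[n∸m]≡n (m/n≤m n 2))))

sperner : (L : List (Vector Bool n)) → Antichain L → length L ≤ n C (n / 2)
sperner {n} L ac = begin
  length L              ≡⟨ m*n/n≡m (length L) c ⟨
  length L * c / c      ≤⟨ /-monoˡ-≤ c (≤-trans (length*≤sum weight weight-minimum L) (lym L ac)) ⟩
  n ! / c               ≡⟨ nCk≡n!/k![n-k]! (m/n≤m n 2) ⟨
  n C (n / 2)           ∎
  where
  open ≤-Reasoning
  c : ℕ
  c = (n / 2) ! * (n ∸ n / 2) !
  instance _ = (n / 2) !* (n ∸ n / 2) !≢0

-- Orientations of K(3,p,q) of diameter at most two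

allSubsets : ∀ n → List (Subset n)
allSubsets zero    = [] ∷ []
allSubsets (suc n) = map (true ∷_) (allSubsets n) ++ map (false ∷_) (allSubsets n)

∈-allSubsets : ∀ {n} (k : Subset n) → k ∈ allSubsets n
∈-allSubsets []          = here refl
∈-allSubsets (true ∷ k)  = ∈-++⁺ˡ (∈-map⁺ (true ∷_) (∈-allSubsets k))
∈-allSubsets (false ∷ k) = ∈-++⁺ʳ _ (∈-map⁺ (false ∷_) (∈-allSubsets k))

∈-bools : ∀ b → b ∈ true ∷ false ∷ []
∈-bools true  = here refl
∈-bools false = there (here refl)

_≟ˢ_ : ∀ {n} → DecidableEquality (Subset n)
_≟ˢ_ = ≡-decᵛ _≟ᵇ_

module Arcs {p q : ℕ} (D : Orientation p q) where
  open Orientation D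

  arc? : (u v : Vertex p q) → Dec (u ⇒ v)
  arc? u v with part u ≟ᶠ part v
  ... | yes same = no (samePart u v same)
  ... | no  diff with total u v diff
  ...   | inj₁ u⇒v = yes u⇒v
  ...   | inj₂ v⇒u = no (antisym v u v⇒u)

  _⇒ᵇ_ : Vertex p q → Vertex p q → Bool
  u ⇒ᵇ v = isYes (arc? u v)

  ⇒ᵇ-true : ∀ {u v} → u ⇒ v → u ⇒ᵇ v ≡ true
  ⇒ᵇ-true = Equivalence.to T-≡ ∘ fromWitness

  ⇒ᵇ-false : ∀ {u v} → v ⇒ u → u ⇒ᵇ v ≡ false
  ⇒ᵇ-false v⇒u = Equivalence.to T-not-≡ (fromWitnessFalse (antisym _ _ v⇒u))

  ⇒ᵇ-sound : ∀ {u v} → u ⇒ᵇ v ≡ true → u ⇒ v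
  ⇒ᵇ-sound = toWitness ∘ Equivalence.from T-≡

  ⇒ᵇ-agree⇒no-detour : ∀ {u u′ w} → u ⇒ᵇ w ≡ u′ ⇒ᵇ w → u ⇒ w → ¬ w ⇒ u′
  ⇒ᵇ-agree⇒no-detour agree u⇒w w⇒u′
    with trans (sym (⇒ᵇ-true u⇒w)) (trans agree (⇒ᵇ-false w⇒u′))
  ... | ()

  type : Fin q → Subset 3
  type z = tabulate (λ i → v3 z ⇒ᵇ v1 i)

  lookup-type : ∀ z i → lookup (type z) i ≡ v3 z ⇒ᵇ v1 i
  lookup-type z = lookup∘tabulate (λ i → v3 z ⇒ᵇ v1 i)

  type≡⇒arcs-agree : ∀ {z z′} → type z ≡ type z′ → ∀ i → v3 z ⇒ᵇ v1 i ≡ v3 z′ ⇒ᵇ v1 i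
  type≡⇒arcs-agree {z} {z′} type≡ i =
    trans (sym (lookup-type z i)) (trans (cong (λ k → lookup k i) type≡) (lookup-type z′ i))

  ⇒-lookup-type : ∀ {z i} → v3 z ⇒ v1 i → lookup (type z) i ≡ true
  ⇒-lookup-type {z} {i} z⇒x = trans (lookup-type z i) (⇒ᵇ-true z⇒x)

  type≡⊤⇒dominates-V1 : ∀ {z} → type z ≡ ⊤ → ∀ i → v3 z ⇒ v1 i
  type≡⊤⇒dominates-V1 {z} type≡⊤ i =
    ⇒ᵇ-sound (trans (sym (lookup-type z i))
               (trans (cong (λ k → lookup k i) type≡⊤) (lookup-replicate i true)))

module Diameter≤2 {p q : ℕ} (D : Orientation p q) (diam : ∀ u v → Dist≤2 D u v) where
  open Orientation D
  open Arcs D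

  arc-without-detour : ∀ {u v} → u ≢ v → (∀ w → u ⇒ w → ¬ w ⇒ v) → u ⇒ v
  arc-without-detour {u} {v} u≢v no-detour with diam u v
  ... | inj₁ (inj₁ u≡v)       = contradiction u≡v u≢v
  ... | inj₁ (inj₂ u⇒v)       = u⇒v
  ... | inj₂ (w , u⇒w , w⇒v) = contradiction w⇒v (no-detour w u⇒w)

  detour-in-part : ∀ {u v} → u ≢ v → part u ≡ part v → ∃[ w ] (u ⇒ w × w ⇒ v)
  detour-in-part {u} {v} u≢v same with diam u v
  ... | inj₁ (inj₁ u≡v) = contradiction u≡v u≢v
  ... | inj₁ (inj₂ u⇒v) = contradiction u⇒v (samePart u v same)
  ... | inj₂ detour     = detour

  dominates-V2⇒dominated-by-V3 : ∀ {i} → (∀ y → v1 i ⇒ v2 y) → ∀ z → v3 z ⇒ v1 i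
  dominates-V2⇒dominated-by-V3 x⇒V2 z = arc-without-detour (λ ()) λ where
    (v1 _) _   w⇒x → samePart _ _ refl w⇒x
    (v2 y) _   y⇒x → antisym _ _ (x⇒V2 y) y⇒x
    (v3 _) z⇒w _   → samePart _ _ refl z⇒w

  dominated-by-V2⇒dominates-V3 : ∀ {i} → (∀ y → v2 y ⇒ v1 i) → ∀ z → v1 i ⇒ v3 z
  dominated-by-V2⇒dominates-V3 V2⇒x z = arc-without-detour (λ ()) λ where
    (v1 _) x⇒w _   → samePart _ _ refl x⇒w
    (v2 y) x⇒y _   → antisym _ _ (V2⇒x y) x⇒y
    (v3 _) _   w⇒z → samePart _ _ refl w⇒z

  dominated-by-V1⇒dominates-V3 : ∀ {y} → (∀ i → v1 i ⇒ v2 y) → ∀ z → v2 y ⇒ v3 z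
  dominated-by-V1⇒dominates-V3 V1⇒y z = arc-without-detour (λ ()) λ where
    (v1 i) y⇒x _   → antisym _ _ (V1⇒y i) y⇒x
    (v2 _) y⇒w _   → samePart _ _ refl y⇒w
    (v3 _) _   w⇒z → samePart _ _ refl w⇒z

  dominates-V1⇒dominated-by-V2 : ∀ {z} → (∀ i → v3 z ⇒ v1 i) → ∀ y → v2 y ⇒ v3 z
  dominates-V1⇒dominated-by-V2 z⇒V1 y = arc-without-detour (λ ()) λ where
    (v1 i) _   x⇒z → antisym _ _ (z⇒V1 i) x⇒z
    (v2 _) y⇒w _   → samePart _ _ refl y⇒w
    (v3 _) _   w⇒z → samePart _ _ refl w⇒z

  V1-dominator-unique : ∀ {z z′} → (∀ i → v3 z ⇒ v1 i) → (∀ i → v3 z′ ⇒ v1 i) → z ≡ z′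
  V1-dominator-unique {z} {z′} z⇒V1 z′⇒V1 with z ≟ᶠ z′
  ... | yes z≡z′ = z≡z′
  ... | no  z≢z′ with detour-in-part {v3 z} {v3 z′} (λ { refl → z≢z′ refl }) refl
  ...   | v1 i , _   , x⇒z′ = ⊥-elim (antisym _ _ (z′⇒V1 i) x⇒z′)
  ...   | v2 y , z⇒y , _    = ⊥-elim (antisym _ _ z⇒y (dominates-V1⇒dominated-by-V2 z⇒V1 y))
  ...   | v3 _ , z⇒w , _    = ⊥-elim (samePart _ _ refl z⇒w)

  V2⊆N[A]⇒type≡A : ∀ {A} → (∀ y → InN D A (v2 y)) → ∀ z → type z ≡ A
  V2⊆N[A]⇒type≡A {A} V2⊆N[A] z = trans (tabulate-cong arc≡A[i]) (tabulate∘lookup A)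
    where
    arc≡A[i] : ∀ i → v3 z ⇒ᵇ v1 i ≡ lookup A i
    arc≡A[i] i with lookup A i in A[i]
    ... | true  = ⇒ᵇ-true
                    (dominates-V2⇒dominated-by-V3 (λ y → proj₁ (V2⊆N[A] y i) (lookup⇒[]= i A A[i])) z)
    ... | false = ⇒ᵇ-false (dominated-by-V2⇒dominates-V3 (λ y → proj₂ (V2⊆N[A] y i) i∉A) z)
      where
      i∉A : ¬ A [ i ]= true
      i∉A i∈A with trans (sym ([]=⇒lookup i∈A)) A[i]
      ... | ()

module V3-classes {p′ q : ℕ} (D : Orientation (suc p′) q) (diam : ∀ u v → Dist≤2 D u v) where
  open Orientation D
  open Arcs D
  open Diameter≤2 D diam

  -- Out-neighbourhood of z in V2 ∖ {t}, indexed through punchIn t.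
  N⁺ : Fin (suc p′) → Fin q → Vector Bool p′
  N⁺ t z j = v3 z ⇒ᵇ v2 (punchIn t j)

  profile : Fin (suc p′) → Fin q → Subset 3 × Bool
  profile t z = type z , v3 z ⇒ᵇ v2 t

  -- There is a path z → w → z′, and a common profile forces w ∈ V2 ∖ {t}.
  same-profile⇒⊈ : ∀ {t z z′} → z ≢ z′ → profile t z ≡ profile t z′ → ¬ N⁺ t z ⊆ N⁺ t z′
  same-profile⇒⊈ {t} {z} {z′} z≢z′ same N⁺z⊆N⁺z′
    with detour-in-part {v3 z} {v3 z′} (λ { refl → z≢z′ refl }) refl
  ... | v3 _ , z⇒w , _    = samePart _ _ refl z⇒w
  ... | v1 i , z⇒x , x⇒z′ = ⇒ᵇ-agree⇒no-detour (type≡⇒arcs-agree (cong proj₁ same) i) z⇒x x⇒z′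
  ... | v2 y , z⇒y , y⇒z′ with t ≟ᶠ y
  ...   | yes refl = ⇒ᵇ-agree⇒no-detour (cong proj₂ same) z⇒y y⇒z′
  ...   | no  t≢y  = antisym _ _ y⇒z′ (subst (λ y → v3 z′ ⇒ v2 y) (punchIn-punchOut t≢y)
                       (toWitness (N⁺z⊆N⁺z′ (punchOut t≢y)
                         (subst (λ y → T (v3 z ⇒ᵇ v2 y)) (sym (punchIn-punchOut t≢y)) (fromWitness z⇒y)))))

  profile-class-bound : ∀ t k {zs : List (Fin q)} → Unique zs → All (λ z → profile t z ≡ k) zs →
    length zs ≤ p′ C (p′ / 2)
  profile-class-bound t k {zs} distinct same = subst (_≤ p′ C (p′ / 2)) (length-map (N⁺ t) zs)
    (sperner (map (N⁺ t) zs) (map⁺ (allPairs-under incomparable same distinct)))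
    where
    incomparable : ∀ {z z′} → profile t z ≡ k → profile t z′ ≡ k → z ≢ z′ →
                   Incomparable (N⁺ t z) (N⁺ t z′)
    incomparable pz pz′ z≢z′ = same-profile⇒⊈ z≢z′ (trans pz (sym pz′))
                             , same-profile⇒⊈ (z≢z′ ∘ sym) (trans pz′ (sym pz))

  type-class-bound : Fin 3 → Subset 3 → ℕ
  type-class-bound a k with lookup k a | k ≟ˢ ⊤
  ... | false | _     = 0
  ... | true  | yes _ = 1
  ... | true  | no  _ = p′ C (p′ / 2)

  ∑-type-class-bound : ∀ a → sum (map (type-class-bound a) (allSubsets 3)) ≡ 1 + 3 * (p′ C (p′ / 2))
  ∑-type-class-bound zero             = refl
  ∑-type-class-bound (suc zero)       = refl
  ∑-type-class-bound (suc (suc zero)) = refl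

  q-bound-if-V1⇒t : ∀ t a → (∀ i → v1 i ⇒ v2 t) → (∀ y → v1 a ⇒ v2 y) → q ≤ 1 + 3 * (p′ C (p′ / 2))
  q-bound-if-V1⇒t t a V1⇒t xa⇒V2 = begin
    q
      ≡⟨ length-tabulate (λ z → z) ⟨
    length zs
      ≤⟨ length≤∑-class _≟ˢ_ type (allSubsets 3) (∈-allSubsets ∘ type) zs ⟩
    sum (map (λ k → length (class _≟ˢ_ type k zs)) (allSubsets 3))
      ≤⟨ sum-map-mono class≤bound (allSubsets 3) ⟩
    sum (map (type-class-bound a) (allSubsets 3))
      ≡⟨ ∑-type-class-bound a ⟩
    1 + 3 * (p′ C (p′ / 2))
      ∎
    where
    open ≤-Reasoning
    zs : List (Fin q)
    zs = allFin q
    V3⇒xa : ∀ z → v3 z ⇒ v1 a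
    V3⇒xa = dominates-V2⇒dominated-by-V3 xa⇒V2
    t⇒V3 : ∀ z → v2 t ⇒ v3 z
    t⇒V3 = dominated-by-V1⇒dominates-V3 V1⇒t
    class≤bound : ∀ k → length (class _≟ˢ_ type k zs) ≤ type-class-bound a k
    class≤bound k with lookup k a in k[a] | k ≟ˢ ⊤
    ... | false | _ = ≤-reflexive (cong length (filter-none _ (All.universal a∉k zs)))
      where
      a∉k : ∀ z → type z ≢ k
      a∉k z type≡k
        with trans (sym (⇒-lookup-type (V3⇒xa z))) (trans (cong (λ k → lookup k a) type≡k) k[a])
      ... | ()
    ... | true | yes refl = length≤1-if-subsingleton (filter⁺ _ (allFin⁺ q))
                              (All.map type≡⊤⇒dominates-V1 (all-filter _ zs)) V1-dominator-unique
    ... | true | no _ = profile-class-bound t (k , false) (filter⁺ _ (allFin⁺ q))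
                          (All.map (λ {z} type≡k → cong₂ _,_ type≡k (⇒ᵇ-false (t⇒V3 z))) (all-filter _ zs))

  q-bound-if-V2⊆N[A] : (A : Subset 3) → (∀ y → InN D A (v2 y)) → q ≤ 2 * (p′ C (p′ / 2))
  q-bound-if-V2⊆N[A] A V2⊆N[A] = begin
    q                                                       ≡⟨ length-tabulate (λ z → z) ⟨
    length zs                                               ≤⟨ length≤∑-class _≟ᵇ_ t-arc bools (∈-bools ∘ t-arc) zs ⟩
    sum (map (λ b → length (class _≟ᵇ_ t-arc b zs)) bools)  ≤⟨ sum-map-mono class≤bound bools ⟩
    2 * (p′ C (p′ / 2))                                     ∎
    where
    open ≤-Reasoning
    zs : List (Fin q)
    zs = allFin q
    bools : List Bool
    bools = true ∷ false ∷ []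
    t-arc : Fin q → Bool
    t-arc z = v3 z ⇒ᵇ v2 zero
    class≤bound : ∀ b → length (class _≟ᵇ_ t-arc b zs) ≤ p′ C (p′ / 2)
    class≤bound b = profile-class-bound zero (A , b) (filter⁺ _ (allFin⁺ q))
                      (All.map (λ {z} → cong₂ _,_ (V2⊆N[A]⇒type≡A V2⊆N[A] z)) (all-filter _ zs))

lemma4p4 : (p q : ℕ) → 3 ≤ p → p ≤ q →
    (D : Orientation p q) → DiameterTwo D →
    (A : Subset 3) → Nonempty A → ¬ (A ≡ ⊤) →
    (∀ (y : _) → InN D ⊤ (v2 {p} {q} y) ⊎ InN D A (v2 y)) →
    q ≤ 1 + 3 * ((p ∸ 1) C ((p ∸ 1) / 2))
lemma4p4 (suc p′) q _ _ D (diam , _) A (a , a∈A) _ V2⊆N[⊤]∪N[A]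
  with any? (λ y → all? (λ i → Arcs.arc? D (v1 i) (v2 y)))
... | yes (t , V1⇒t) = q-bound-if-V1⇒t t a V1⇒t xa⇒V2
  where
  open Orientation D using (_⇒_)
  open V3-classes D diam
  xa⇒V2 : ∀ y → v1 a ⇒ v2 y
  xa⇒V2 y = [ (λ y∈N[⊤] → proj₁ (y∈N[⊤] a) ∈⊤) , (λ y∈N[A] → proj₁ (y∈N[A] a) a∈A) ]′
               (V2⊆N[⊤]∪N[A] y)
... | no ∄t =
  ≤-trans (q-bound-if-V2⊆N[A] A V2⊆N[A]) (m≤n⇒m≤1+n (*-monoˡ-≤ (p′ C (p′ / 2)) (n≤1+n 2)))
  where
  open V3-classes D diam
  V2⊆N[A] : ∀ y → InN D A (v2 y)
  V2⊆N[A] y = [ (λ y∈N[⊤] → contradiction (y , λ i → proj₁ (y∈N[⊤] i) ∈⊤) ∄t) , id ]′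
                 (V2⊆N[⊤]∪N[A] y)
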